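{- Let $G$ be a finite graph. Then $\mathrm{c\text{ - }rk}\,G\ge5$ if and only if $G$ has five distinct vertices $v_1,\dots,v_5$ with $v_1$ adjacent to each of $v_2,v_3,v_4$ and $v_5$ adjacent to each of $v_2,v_3,v_4$, such that $\mathrm{St}(v_1)\neq\mathrm{St}(v_5)$, $\mathrm{St}(v_2)\neq\mathrm{St}(v_3)$ and $\mathrm{St}(v_2)\cap\mathrm{St}(v_3)\not\subseteq\mathrm{St}(v_4)$.
   Context: Graphs are finite, undirected, without loops or multiple edges. $\mathrm{St}(v)$ is the set of neighbours of $v$. $\mathrm{c\text{ - }rk}\,G$ is the maximum number of independent columns of the $V\times V$ boolean matrix $A^c$ (entry $0$ if $\{i,j\}\in E$, else $1$), where vectors over the superboolean semiring $\{0,1,1^\nu\}$ (with $0+x=x$, $1+1=1^\nu$, $1^\nu+x=1^\nu$, $0\cdot x=0$, $1\cdot1=1$, $1\cdot1^\nu=1^\nu\cdot1^\nu=1^\nu$) are dependent if some $\{0,1\}$-combination with not all coefficients zero has all coordinates in $\{0,1^\nu\}$, and independent otherwise. -}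

module Defs where

open import Data.Nat using (ℕ; _≤_)
open import Data.Bool using (Bool; true; false; if_then_else_)
open import Data.Fin using (Fin)
open import Data.List using (List; foldr; allFin)
open import Data.Fin.Subset using (Subset; _∈_; _⊆_; Nonempty; ∣_∣)
open import Data.Vec using (lookup)
open import Data.Product using (Σ; ∃; ∃-syntax; _×_)
open import Relation.Binary.PropositionalEquality using (_≡_; _≢_)
open import Relation.Nullary using (¬_)
open import Relation.Unary using (Pred)
open import Level using (0ℓ)

record Graph : Set where
  field
    n      : ℕ
    adj    : Fin n → Fin n → Bool
    sym    : ∀ i j → adj i j ≡ adj j i
    irrefl : ∀ i → adj i i ≡ false
open Graph public

St : (G : Graph) → Fin (n G) → Pred (Fin (n G)) 0ℓ
St G v u = adj G v u ≡ true

data SB : Set where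
  𝟘 𝟙 𝟙ν : SB

infixl 6 _⊕_
infixl 7 _⊗_
_⊕_ : SB → SB → SB
𝟘  ⊕ x = x
𝟙  ⊕ 𝟘 = 𝟙
𝟙  ⊕ 𝟙 = 𝟙ν
𝟙  ⊕ 𝟙ν = 𝟙ν
𝟙ν ⊕ x = 𝟙ν

_⊗_ : SB → SB → SB
𝟘  ⊗ x = 𝟘
𝟙  ⊗ x = x
𝟙ν ⊗ 𝟘 = 𝟘
𝟙ν ⊗ 𝟙 = 𝟙ν
𝟙ν ⊗ 𝟙ν = 𝟙ν

Ac : (G : Graph) → Fin (n G) → Fin (n G) → SB
Ac G i j = if adj G i j then 𝟘 else 𝟙

coef : Bool → SB
coef true  = 𝟙
coef false = 𝟘

-- i-th coordinate of the {0,1}-combination Σ_j c_j · (column j of A^c).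
combo : (G : Graph) → Subset (n G) → Fin (n G) → SB
combo G c i = foldr (λ j acc → coef (lookup c j) ⊗ Ac G i j ⊕ acc) 𝟘 (allFin (n G))

DependentCols : (G : Graph) → Subset (n G) → Set
DependentCols G S =
  ∃[ c ] (c ⊆ S × Nonempty c × (∀ i → combo G c i ≢ 𝟙))

IndependentCols : (G : Graph) → Subset (n G) → Set
IndependentCols G S = ¬ DependentCols G S

c-rk≥ : Graph → ℕ → Set
c-rk≥ G k = ∃[ S ] (IndependentCols G S × k ≤ ∣ S ∣)

module Submission where

-- Write i ∼ j for adjacency, so that the entry (i, j) of A^c is 1 iff i ≁ j.
-- Since SB has no cancellation, a coordinate of a {0,1}-combination of columns is 1 exactly
-- when that row has a single entry 1 on the chosen columns.  Hence a column set S is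
-- independent iff every nonempty c ⊆ S has a row isolating one column of c
-- (independent⇔isolable).  Peeling off isolated columns, and conversely reading a family
-- in order, this says that c-rk G ≥ k iff A^c has k columns t₁, …, t_k in triangular form:
-- for each m some row i_m has i_m ≁ t_m and i_m ∼ t_l for all l > m (rank⇔triangular).
-- For k = 5 such a triangle is equivalent to the configuration of the proposition:
-- v₁ = i₁, v₅ = i₂, (v₂, v₃, v₄) = (t₄, t₅, t₃) in one direction (triangle⇒configuration),
-- and in the other the vertices witnessing St(v₁) ≠ St(v₅), St(v₂) ≠ St(v₃) and
-- St(v₂) ∩ St(v₃) ⊈ St(v₄) serve as the rows (configuration⇒triangle).

open import Defs
open import Data.Bool using (Bool; true; false; if_then_else_)
open import Data.Bool.Properties using (_≟_; ¬-not)
open import Data.Empty using (⊥-elim)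
open import Data.Fin using (Fin; zero; suc)
open import Data.Fin.Properties using (any?; suc-injective)
open import Data.Fin.Subset
  using (Subset; Nonempty; ∣_∣; ⁅_⁆; _-_; ⋃; inside; outside)
  renaming (_∈_ to _∈ₛ_; _∉_ to _∉ₛ_; _⊆_ to _⊆ₛ_)
open import Data.Fin.Subset.Properties
  using (_∈?_; ∉⊥; nonempty?; Empty-unique; ∣⊥∣≡0; x∈⁅x⁆; x∈⁅y⁆⇒x≡y; x∈p∪q⁻; x∈p∪q⁺;
         x∈p∧x≢y⇒x∈p-y; p─q⊆p; p─⊥≡p; x∈p⇒∣p-x∣<∣p∣; p⊆q⇒∣p∣≤∣q∣)
open import Data.List using (List; []; _∷_; length; map; foldr; tabulate)
open import Data.List.Relation.Unary.All as All using (All; []; _∷_)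
open import Data.Nat using (zero; suc; _≤_; s≤s; z≤n)
open import Data.Nat.Properties using (≤-trans; ≤-pred)
open import Data.Product using (∃-syntax; _×_; _,_; proj₁; proj₂)
open import Data.Sum using (_⊎_; inj₁; inj₂)
open import Data.Vec using (_∷_; lookup; here; there)
open import Data.Vec.Properties using ([]=⇒lookup; lookup⇒[]=)
open import Function using (_∘_)
open import Function.Bundles using (_⇔_; mk⇔; Equivalence)
open import Relation.Binary.PropositionalEquality
  using (_≡_; _≢_; refl; trans; cong; subst; ≢-sym)
  renaming (sym to ≡-sym)
open import Relation.Nullary using (¬_; ¬?; Dec; yes; no; contradiction)
open import Relation.Nullary.Decidable using (_×-dec_; decidable-stable)
open import Relation.Unary using (_⊆_; _∩_; _≐_)
open import Relation.Unary.Properties using (≐-sym)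

open Equivalence using (to; from)

sumSB : ∀ {m} → (Fin m → SB) → SB
sumSB {zero}  h = 𝟘
sumSB {suc m} h = h zero ⊕ sumSB (h ∘ suc)

SingleOne : ∀ {m} → (Fin m → SB) → Set
SingleOne h = ∃[ t ] (h t ≡ 𝟙 × (∀ j → j ≢ t → h j ≡ 𝟘))

⊕-zero⁻ : ∀ x y → x ⊕ y ≡ 𝟘 → x ≡ 𝟘 × y ≡ 𝟘
⊕-zero⁻ 𝟘 y e = refl , e
⊕-zero⁻ 𝟙 𝟘 ()
⊕-zero⁻ 𝟙 𝟙 ()
⊕-zero⁻ 𝟙 𝟙ν ()
⊕-zero⁻ 𝟙ν y ()

𝟙⊕-one⁻ : ∀ y → 𝟙 ⊕ y ≡ 𝟙 → y ≡ 𝟘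
𝟙⊕-one⁻ 𝟘 e = refl
𝟙⊕-one⁻ 𝟙 ()
𝟙⊕-one⁻ 𝟙ν ()

sumSB-zero⁻ : ∀ {m} (h : Fin m → SB) → sumSB h ≡ 𝟘 → ∀ j → h j ≡ 𝟘
sumSB-zero⁻ {suc m} h e zero    = proj₁ (⊕-zero⁻ _ _ e)
sumSB-zero⁻ {suc m} h e (suc j) = sumSB-zero⁻ (h ∘ suc) (proj₂ (⊕-zero⁻ _ _ e)) j

sumSB-zero⁺ : ∀ {m} (h : Fin m → SB) → (∀ j → h j ≡ 𝟘) → sumSB h ≡ 𝟘
sumSB-zero⁺ {zero}  h z = refl
sumSB-zero⁺ {suc m} h z rewrite z zero = sumSB-zero⁺ (h ∘ suc) (z ∘ suc)

-- A sum equals 1 exactly when one term is 1 and all others are 0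
-- (two 1's already add up to 1^ν, and 1^ν absorbs).
sumSB≡𝟙⇔SingleOne : ∀ {m} (h : Fin m → SB) → sumSB h ≡ 𝟙 ⇔ SingleOne h
sumSB≡𝟙⇔SingleOne h = mk⇔ (single h) (sum h)
  where
  single : ∀ {m} (h : Fin m → SB) → sumSB h ≡ 𝟙 → SingleOne h
  single {suc m} h e with h zero in h₀
  ... | 𝟘 with single (h ∘ suc) e
  ...   | t , ht , rest = suc t , ht , λ { zero _ → h₀ ; (suc j) j≢t → rest j (j≢t ∘ cong suc) }
  single {suc m} h e | 𝟙 =
    zero , h₀ , λ { zero j≢0 → contradiction refl j≢0
                  ; (suc j) _ → sumSB-zero⁻ (h ∘ suc) (𝟙⊕-one⁻ _ e) j }
  single {suc m} h () | 𝟙ν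

  sum : ∀ {m} (h : Fin m → SB) → SingleOne h → sumSB h ≡ 𝟙
  sum {suc m} h (zero , ht , rest)
    rewrite ht | sumSB-zero⁺ (h ∘ suc) (λ j → rest (suc j) λ ()) = refl
  sum {suc m} h (suc t , ht , rest)
    rewrite rest zero (λ ()) = sum (h ∘ suc) (t , ht , λ j j≢t → rest (suc j) (j≢t ∘ suc-injective))

term≡𝟙⇔ : ∀ b a → coef b ⊗ (if a then 𝟘 else 𝟙) ≡ 𝟙 ⇔ (b ≡ true × a ≡ false)
term≡𝟙⇔ b a = mk⇔ (forth b a) λ { (refl , refl) → refl }
  where
  forth : ∀ b a → coef b ⊗ (if a then 𝟘 else 𝟙) ≡ 𝟙 → b ≡ true × a ≡ false
  forth true false _ = refl , refl
  forth true true ()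
  forth false a ()

term≡𝟘⇔ : ∀ b a → coef b ⊗ (if a then 𝟘 else 𝟙) ≡ 𝟘 ⇔ (b ≡ true → a ≡ true)
term≡𝟘⇔ b a = mk⇔ (forth b a) (back b a)
  where
  forth : ∀ b a → coef b ⊗ (if a then 𝟘 else 𝟙) ≡ 𝟘 → b ≡ true → a ≡ true
  forth true true _ _ = refl
  forth true false () _
  back : ∀ b a → (b ≡ true → a ≡ true) → coef b ⊗ (if a then 𝟘 else 𝟙) ≡ 𝟘
  back false a _ = refl
  back true a imp rewrite imp refl = refl

foldr-tabulate : ∀ {k m} (h : Fin k → SB) (f : Fin m → Fin k) →
  foldr (λ j acc → h j ⊕ acc) 𝟘 (tabulate f) ≡ sumSB (h ∘ f)
foldr-tabulate {m = zero}  h f = refl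
foldr-tabulate {m = suc m} h f = cong (h (f zero) ⊕_) (foldr-tabulate h (f ∘ suc))

is𝟙? : (x : SB) → Dec (x ≡ 𝟙)
is𝟙? 𝟘  = no λ ()
is𝟙? 𝟙  = yes refl
is𝟙? 𝟙ν = no λ ()

∣p∣≡1+∣p-x∣ : ∀ {m} {x : Fin m} {p : Subset m} → x ∈ₛ p → ∣ p ∣ ≡ suc ∣ p - x ∣
∣p∣≡1+∣p-x∣ {x = zero} {inside ∷ p} here = cong suc (≡-sym (cong ∣_∣ (p─⊥≡p p)))
∣p∣≡1+∣p-x∣ {x = suc x} {inside ∷ p} (there x∈p) = cong suc (∣p∣≡1+∣p-x∣ x∈p)
∣p∣≡1+∣p-x∣ {x = suc x} {outside ∷ p} (there x∈p) = ∣p∣≡1+∣p-x∣ x∈p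

≢-cases : ∀ {a b : Bool} → a ≢ b → (a ≡ true × b ≡ false) ⊎ (b ≡ true × a ≡ false)
≢-cases {true}  {false} _ = inj₁ (refl , refl)
≢-cases {false} {true}  _ = inj₂ (refl , refl)
≢-cases {true}  {true}  a≢b = contradiction refl a≢b
≢-cases {false} {false} a≢b = contradiction refl a≢b

x∉p-x : ∀ {m} (x : Fin m) (p : Subset m) → x ∉ₛ p - x
x∉p-x zero    (s ∷ p) ()
x∉p-x (suc x) (s ∷ p) (there x∈p-x) = x∉p-x x p x∈p-x

x∈p-y⇒x≢y : ∀ {m} {x y : Fin m} {p : Subset m} → x ∈ₛ p - y → x ≢ y
x∈p-y⇒x≢y {x = x} {p = p} x∈p-x refl = x∉p-x x p x∈p-x

size⇒nonempty : ∀ {m} (p : Subset m) → 1 ≤ ∣ p ∣ → Nonempty p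
size⇒nonempty {m} p 1≤∣p∣ with nonempty? p
... | yes ne = ne
... | no empty with () ← subst (1 ≤_) (trans (cong ∣_∣ (Empty-unique empty)) (∣⊥∣≡0 m)) 1≤∣p∣

module _ (G : Graph) where

  private
    V : Set
    V = Fin (n G)

  adj-sym : ∀ {a b e} → adj G a b ≡ e → adj G b a ≡ e
  adj-sym {a} {b} = trans (Graph.sym G b a)

  adj⇒≢ : ∀ {a b} → adj G a b ≡ true → a ≢ b
  adj⇒≢ {a} a∼a refl with () ← trans (≡-sym a∼a) (irrefl G a)

  separated⇒≢ : ∀ {u a b} → adj G u a ≡ false → adj G u b ≡ true → a ≢ b
  separated⇒≢ u≁a u∼b refl with () ← trans (≡-sym u≁a) u∼b

  -- Row i of A^c isolates column t inside the column set c: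
  -- the entry (i,t) is 1 while every other entry (i,j), j ∈ c, is 0.
  Isolates : Subset (n G) → V → V → Set
  Isolates c i t = t ∈ₛ c × adj G i t ≡ false × (∀ {j} → j ∈ₛ c → j ≢ t → adj G i j ≡ true)

  combo≡𝟙⇔isolates : ∀ c i → combo G c i ≡ 𝟙 ⇔ (∃[ t ] Isolates c i t)
  combo≡𝟙⇔isolates c i = mk⇔ forth back
    where
    entry : V → SB
    entry j = coef (lookup c j) ⊗ Ac G i j

    combo≡sum : combo G c i ≡ sumSB entry
    combo≡sum = foldr-tabulate entry (λ j → j)

    forth : combo G c i ≡ 𝟙 → ∃[ t ] Isolates c i t
    forth e with to (sumSB≡𝟙⇔SingleOne entry) (trans (≡-sym combo≡sum) e)
    ... | t , et , others with to (term≡𝟙⇔ (lookup c t) (adj G i t)) et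
    ...   | t∈c , i≁t = t , lookup⇒[]= t c t∈c , i≁t ,
              λ {j} j∈c j≢t → to (term≡𝟘⇔ _ _) (others j j≢t) ([]=⇒lookup j∈c)

    back : ∃[ t ] Isolates c i t → combo G c i ≡ 𝟙
    back (t , t∈c , i≁t , i∼rest) = trans combo≡sum (from (sumSB≡𝟙⇔SingleOne entry)
      (t , from (term≡𝟙⇔ _ _) ([]=⇒lookup t∈c , i≁t) ,
       λ j j≢t → from (term≡𝟘⇔ _ _) λ cj → i∼rest (lookup⇒[]= j c cj) j≢t))

  Isolable : Subset (n G) → Set
  Isolable S = ∀ {c} → c ⊆ₛ S → Nonempty c → ∃[ i ] ∃[ t ] Isolates c i t

  independent⇔isolable : ∀ S → IndependentCols G S ⇔ Isolable S
  independent⇔isolable S = mk⇔ forth back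
    where
    forth : IndependentCols G S → Isolable S
    forth indep {c} c⊆S ne with any? (λ i → is𝟙? (combo G c i))
    ... | yes (i , e) = i , to (combo≡𝟙⇔isolates c i) e
    ... | no none = ⊥-elim (indep (c , c⊆S , ne , λ i e → none (i , e)))

    back : Isolable S → IndependentCols G S
    back isolable (c , c⊆S , ne , no𝟙) with isolable c⊆S ne
    ... | i , iso = no𝟙 i (from (combo≡𝟙⇔isolates c i) iso)

  Separates : V → V → List V → Set
  Separates i t ts = adj G i t ≡ false × All (λ j → adj G i j ≡ true) ts

  -- Columns t₁, …, t_k in triangular form: each t_m is separated from t_{m+1}, …, t_k
  -- by some row.  Up to reordering, this is a triangular k × k minor of A^c.
  data Triangular : List V → Set where
    []  : Triangular []
    _∷_ : ∀ {t ts} → ∃[ i ] Separates i t ts → Triangular ts → Triangular (t ∷ ts)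

  ⟦_⟧ : List V → Subset (n G)
  ⟦ ts ⟧ = ⋃ (map ⁅_⁆ ts)

  ∈⟦∷⟧⁻ : ∀ {x} t ts → x ∈ₛ ⟦ t ∷ ts ⟧ → x ≡ t ⊎ x ∈ₛ ⟦ ts ⟧
  ∈⟦∷⟧⁻ t ts x∈ with x∈p∪q⁻ ⁅ t ⁆ ⟦ ts ⟧ x∈
  ... | inj₁ x∈⁅t⁆ = inj₁ (x∈⁅y⁆⇒x≡y t x∈⁅t⁆)
  ... | inj₂ x∈ts  = inj₂ x∈ts

  ∈⟦∷⟧-tail : ∀ {x} t ts → x ∈ₛ ⟦ t ∷ ts ⟧ → x ≢ t → x ∈ₛ ⟦ ts ⟧
  ∈⟦∷⟧-tail t ts x∈ x≢t with ∈⟦∷⟧⁻ t ts x∈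
  ... | inj₁ x≡t  = contradiction x≡t x≢t
  ... | inj₂ x∈ts = x∈ts

  All⇒⟦⟧ : ∀ {P : V → Set} {ts} → All P ts → ∀ {x} → x ∈ₛ ⟦ ts ⟧ → P x
  All⇒⟦⟧ [] x∈⊥ = contradiction x∈⊥ ∉⊥
  All⇒⟦⟧ {ts = t ∷ ts} (pt ∷ pts) x∈ with ∈⟦∷⟧⁻ t ts x∈
  ... | inj₁ refl = pt
  ... | inj₂ x∈ts = All⇒⟦⟧ pts x∈ts

  separated-head∉ : ∀ {i t ts} → Separates i t ts → t ∉ₛ ⟦ ts ⟧
  separated-head∉ (i≁t , i∼ts) t∈ts with () ← trans (≡-sym i≁t) (All⇒⟦⟧ i∼ts t∈ts)

  -- In a triangular family the first chosen column (in list order) is isolated by its row.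
  triangular⇒isolable : ∀ {ts} → Triangular ts → Isolable ⟦ ts ⟧
  triangular⇒isolable [] c⊆⊥ (x , x∈c) = contradiction (c⊆⊥ x∈c) ∉⊥
  triangular⇒isolable {t ∷ ts} ((i , i≁t , i∼ts) ∷ tri) {c} c⊆ ne with t ∈? c
  ... | yes t∈c = i , t , t∈c , i≁t , λ j∈c j≢t → All⇒⟦⟧ i∼ts (∈⟦∷⟧-tail t ts (c⊆ j∈c) j≢t)
  ... | no  t∉c = triangular⇒isolable tri (λ x∈c → ∈⟦∷⟧-tail t ts (c⊆ x∈c) λ { refl → t∉c x∈c }) ne

  -- The columns of a triangular family are pairwise distinct, so there are length ts of them.
  triangular⇒size : ∀ {ts} → Triangular ts → length ts ≤ ∣ ⟦ ts ⟧ ∣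
  triangular⇒size [] = z≤n
  triangular⇒size {t ∷ ts} (sep ∷ tri) =
    ≤-trans (s≤s (≤-trans (triangular⇒size tri) (p⊆q⇒∣p∣≤∣q∣ tail⊆)))
            (x∈p⇒∣p-x∣<∣p∣ (x∈p∪q⁺ (inj₁ (x∈⁅x⁆ t))))
    where
    tail⊆ : ⟦ ts ⟧ ⊆ₛ ⟦ t ∷ ts ⟧ - t
    tail⊆ x∈ts = x∈p∧x≢y⇒x∈p-y (x∈p∪q⁺ (inj₂ x∈ts)) λ { refl → separated-head∉ (proj₂ sep) x∈ts }

  isolable-⊆ : ∀ {c S} → c ⊆ₛ S → Isolable S → Isolable c
  isolable-⊆ c⊆S isolable d⊆c = isolable (c⊆S ∘ d⊆c)

  -- Peeling off isolated columns one at a time turns an isolable set of size ≥ k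
  -- into a triangular family of k of its columns.
  isolable⇒triangular : ∀ k {c} → Isolable c → k ≤ ∣ c ∣ →
    ∃[ ts ] (Triangular ts × length ts ≡ k × All (_∈ₛ c) ts)
  isolable⇒triangular zero    isolable _ = [] , [] , refl , []
  isolable⇒triangular (suc k) {c} isolable k<∣c∣
    with isolable (λ x∈c → x∈c) (size⇒nonempty c (≤-trans (s≤s z≤n) k<∣c∣))
  ... | i , t , t∈c , i≁t , i∼rest
    with isolable⇒triangular k (isolable-⊆ (p─q⊆p c ⁅ t ⁆) isolable)
           (≤-pred (subst (suc k ≤_) (∣p∣≡1+∣p-x∣ t∈c) k<∣c∣))
  ... | ts , tri , refl , ts⊆c-t =
    t ∷ ts ,
    (i , i≁t , All.map (λ j∈ → i∼rest (p─q⊆p c ⁅ t ⁆ j∈) (x∈p-y⇒x≢y j∈)) ts⊆c-t) ∷ tri ,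
    refl ,
    t∈c ∷ All.map (p─q⊆p c ⁅ t ⁆) ts⊆c-t

  rank⇔triangular : ∀ k → c-rk≥ G k ⇔ (∃[ ts ] (Triangular ts × length ts ≡ k))
  rank⇔triangular k = mk⇔ forth back
    where
    forth : c-rk≥ G k → ∃[ ts ] (Triangular ts × length ts ≡ k)
    forth (S , indep , k≤∣S∣)
      with ts , tri , len , _ ← isolable⇒triangular k (to (independent⇔isolable S) indep) k≤∣S∣
      = ts , tri , len

    back : ∃[ ts ] (Triangular ts × length ts ≡ k) → c-rk≥ G k
    back (ts , tri , refl) =
      ⟦ ts ⟧ , from (independent⇔isolable ⟦ ts ⟧) (triangular⇒isolable tri) , triangular⇒size tri

  St-differ : ∀ {u v x} → adj G u x ≡ true → adj G v x ≡ false → ¬ (St G u ≐ St G v)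
  St-differ u∼x v≁x (St-u⊆St-v , _) with () ← trans (≡-sym v≁x) (St-u⊆St-v u∼x)

  St-differ⁻ : ∀ {u v} → ¬ (St G u ≐ St G v) →
    ∃[ x ] ((adj G u x ≡ true × adj G v x ≡ false) ⊎ (adj G v x ≡ true × adj G u x ≡ false))
  St-differ⁻ {u} {v} St≉ with any? (λ x → ¬? (adj G u x ≟ adj G v x))
  ... | yes (x , ne) = x , ≢-cases ne
  ... | no  none     = contradiction ((λ {x} → subst (_≡ true) (agree x))
                                    , (λ {x} → subst (_≡ true) (≡-sym (agree x)))) St≉
    where
    agree : ∀ x → adj G u x ≡ adj G v x
    agree x = decidable-stable (adj G u x ≟ adj G v x) (λ ne → none (x , ne))

  not-in-common : ∀ {a b c x} → adj G x a ≡ true → adj G x b ≡ true → adj G x c ≡ false →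
    ¬ ((St G a ∩ St G b) ⊆ St G c)
  not-in-common x∼a x∼b x≁c ab⊆c with () ← trans (≡-sym (adj-sym x≁c)) (ab⊆c (adj-sym x∼a , adj-sym x∼b))

  not-in-common⁻ : ∀ {a b c} → ¬ ((St G a ∩ St G b) ⊆ St G c) →
    ∃[ w ] (adj G a w ≡ true × adj G b w ≡ true × adj G c w ≡ false)
  not-in-common⁻ {a} {b} {c} ab⊈c
    with any? (λ w → (adj G a w ≟ true) ×-dec (adj G b w ≟ true) ×-dec (adj G c w ≟ false))
  ... | yes found = found
  ... | no  none  = contradiction (λ {w} (a∼w , b∼w) →
          decidable-stable (adj G c w ≟ true) (λ c≁w → none (w , a∼w , b∼w , ¬-not c≁w))) ab⊈c

  Configuration : Set
  Configuration = ∃[ v₁ ] ∃[ v₂ ] ∃[ v₃ ] ∃[ v₄ ] ∃[ v₅ ]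
    ((v₁ ≢ v₂ × v₁ ≢ v₃ × v₁ ≢ v₄ × v₁ ≢ v₅ × v₂ ≢ v₃ × v₂ ≢ v₄ × v₂ ≢ v₅
      × v₃ ≢ v₄ × v₃ ≢ v₅ × v₄ ≢ v₅)
    × (adj G v₁ v₂ ≡ true × adj G v₁ v₃ ≡ true × adj G v₁ v₄ ≡ true)
    × (adj G v₅ v₂ ≡ true × adj G v₅ v₃ ≡ true × adj G v₅ v₄ ≡ true)
    × ¬ (St G v₁ ≐ St G v₅)
    × ¬ (St G v₂ ≐ St G v₃)
    × ¬ ((St G v₂ ∩ St G v₃) ⊆ St G v₄))

  -- Five triangular columns t₁ … t₅ with rows i₁ … i₄ yield the configuration
  -- v₁ = i₁, v₂ = t₄, v₃ = t₅, v₄ = t₃, v₅ = i₂: row i₂ tells i₁ from i₂ at t₂,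
  -- row i₄ tells t₄ from t₅, and row i₃ is a common neighbour of t₄, t₅ outside St(t₃).
  triangle⇒configuration : ∃[ ts ] (Triangular ts × length ts ≡ 5) → Configuration
  triangle⇒configuration
    (_ , (i₁ , _ , i₁∼t₂ ∷ i₁∼t₃ ∷ i₁∼t₄ ∷ i₁∼t₅ ∷ [])
       ∷ (i₂ , i₂≁t₂ , i₂∼t₃ ∷ i₂∼t₄ ∷ i₂∼t₅ ∷ [])
       ∷ (i₃ , i₃≁t₃ , i₃∼t₄ ∷ i₃∼t₅ ∷ [])
       ∷ (i₄ , i₄≁t₄ , i₄∼t₅ ∷ [])
       ∷ _ ∷ [] , refl) =
    i₁ , _ , _ , _ , i₂ ,
    ( adj⇒≢ i₁∼t₄ , adj⇒≢ i₁∼t₅ , adj⇒≢ i₁∼t₃ , ≢-sym (separated⇒≢ (adj-sym i₂≁t₂) (adj-sym i₁∼t₂))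
    , separated⇒≢ i₄≁t₄ i₄∼t₅ , ≢-sym (separated⇒≢ i₃≁t₃ i₃∼t₄) , ≢-sym (adj⇒≢ i₂∼t₄)
    , ≢-sym (separated⇒≢ i₃≁t₃ i₃∼t₅) , ≢-sym (adj⇒≢ i₂∼t₅) , ≢-sym (adj⇒≢ i₂∼t₃) ) ,
    (i₁∼t₄ , i₁∼t₅ , i₁∼t₃) ,
    (i₂∼t₄ , i₂∼t₅ , i₂∼t₃) ,
    St-differ i₁∼t₂ i₂≁t₂ ,
    St-differ (adj-sym i₄∼t₅) (adj-sym i₄≁t₄) ∘ ≐-sym ,
    not-in-common i₃∼t₄ i₃∼t₅ i₃≁t₃

  -- Conversely, suppose u₁, u₅ ∼ p, q, r, the vertex x has u₁ ∼ x ≁ u₅, the vertex b has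
  -- p ∼ b ≁ q, and w ∈ St(p) ∩ St(q) ∖ St(r).  Then the columns u₁, x, r, q, p are
  -- triangular, separated by the rows u₁, u₅, w, b, p (using irreflexivity twice).
  oriented-triangle : ∀ {u₁ u₅ p q r x w b} →
    adj G u₁ p ≡ true → adj G u₁ q ≡ true → adj G u₁ r ≡ true →
    adj G u₅ p ≡ true → adj G u₅ q ≡ true → adj G u₅ r ≡ true →
    adj G u₁ x ≡ true → adj G u₅ x ≡ false →
    adj G p w ≡ true → adj G q w ≡ true → adj G r w ≡ false →
    adj G p b ≡ true → adj G q b ≡ false →
    ∃[ ts ] (Triangular ts × length ts ≡ 5)
  oriented-triangle {u₁} {u₅} {p} {q} {r} {x} {w} {b}
    u₁∼p u₁∼q u₁∼r u₅∼p u₅∼q u₅∼r u₁∼x u₅≁x p∼w q∼w r≁w p∼b q≁b =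
    u₁ ∷ x ∷ r ∷ q ∷ p ∷ [] ,
    (u₁ , irrefl G u₁ , u₁∼x ∷ u₁∼r ∷ u₁∼q ∷ u₁∼p ∷ []) ∷
    (u₅ , u₅≁x , u₅∼r ∷ u₅∼q ∷ u₅∼p ∷ []) ∷
    (w , adj-sym r≁w , adj-sym q∼w ∷ adj-sym p∼w ∷ []) ∷
    (b , adj-sym q≁b , adj-sym p∼b ∷ []) ∷
    (p , irrefl G p , []) ∷ [] ,
    refl

  -- The configuration is symmetric under v₁ ↔ v₅ and v₂ ↔ v₃, so it suffices to orient the
  -- vertices telling St(v₁) from St(v₅) and St(v₂) from St(v₃).
  configuration⇒triangle : Configuration → ∃[ ts ] (Triangular ts × length ts ≡ 5)
  configuration⇒triangle
    (v₁ , v₂ , v₃ , v₄ , v₅ , _ , (v₁∼v₂ , v₁∼v₃ , v₁∼v₄) , (v₅∼v₂ , v₅∼v₃ , v₅∼v₄) , St₁≉St₅ , St₂≉St₃ , ∩⊈St₄)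
    with St-differ⁻ St₁≉St₅ | St-differ⁻ St₂≉St₃ | not-in-common⁻ ∩⊈St₄
  ... | _ , inj₁ (v₁∼x , v₅≁x) | _ , inj₁ (v₂∼b , v₃≁b) | _ , v₂∼w , v₃∼w , v₄≁w =
    oriented-triangle v₁∼v₂ v₁∼v₃ v₁∼v₄ v₅∼v₂ v₅∼v₃ v₅∼v₄ v₁∼x v₅≁x v₂∼w v₃∼w v₄≁w v₂∼b v₃≁b
  ... | _ , inj₁ (v₁∼x , v₅≁x) | _ , inj₂ (v₃∼b , v₂≁b) | _ , v₂∼w , v₃∼w , v₄≁w =
    oriented-triangle v₁∼v₃ v₁∼v₂ v₁∼v₄ v₅∼v₃ v₅∼v₂ v₅∼v₄ v₁∼x v₅≁x v₃∼w v₂∼w v₄≁w v₃∼b v₂≁b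
  ... | _ , inj₂ (v₅∼x , v₁≁x) | _ , inj₁ (v₂∼b , v₃≁b) | _ , v₂∼w , v₃∼w , v₄≁w =
    oriented-triangle v₅∼v₂ v₅∼v₃ v₅∼v₄ v₁∼v₂ v₁∼v₃ v₁∼v₄ v₅∼x v₁≁x v₂∼w v₃∼w v₄≁w v₂∼b v₃≁b
  ... | _ , inj₂ (v₅∼x , v₁≁x) | _ , inj₂ (v₃∼b , v₂≁b) | _ , v₂∼w , v₃∼w , v₄≁w =
    oriented-triangle v₅∼v₃ v₅∼v₂ v₅∼v₄ v₁∼v₃ v₁∼v₂ v₁∼v₄ v₅∼x v₁≁x v₃∼w v₂∼w v₄≁w v₃∼b v₂≁b

-- Proposition 4.4: c-rk G ≥ 5 iff G contains the configuration.
-- Both sides are equivalent to A^c having five columns in triangular form.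
proposition4p4 : (G : Graph) →
    c-rk≥ G 5 ⇔
      (∃[ v₁ ] ∃[ v₂ ] ∃[ v₃ ] ∃[ v₄ ] ∃[ v₅ ]
        ((v₁ ≢ v₂ × v₁ ≢ v₃ × v₁ ≢ v₄ × v₁ ≢ v₅ × v₂ ≢ v₃ × v₂ ≢ v₄ × v₂ ≢ v₅
          × v₃ ≢ v₄ × v₃ ≢ v₅ × v₄ ≢ v₅)
        × (adj G v₁ v₂ ≡ true × adj G v₁ v₃ ≡ true × adj G v₁ v₄ ≡ true)
        × (adj G v₅ v₂ ≡ true × adj G v₅ v₃ ≡ true × adj G v₅ v₄ ≡ true)
        × ¬ (St G v₁ ≐ St G v₅)
        × ¬ (St G v₂ ≐ St G v₃)
        × ¬ ((St G v₂ ∩ St G v₃) ⊆ St G v₄)))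
proposition4p4 G = mk⇔
  (triangle⇒configuration G ∘ to (rank⇔triangular G 5))
  (from (rank⇔triangular G 5) ∘ configuration⇒triangle G)
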